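{- Let $\mathsf{L}\in\{\mathsf{PFL},\mathsf{PQFL},\mathsf{NFL},\mathsf{NQFL},\mathsf{NQFL}^-\}$, let $\mathcal B$ be an open and fully expanded branch of a $\mathsf{TC}_\mathsf{L}$-tableau, and let $\mathsf{TERM}(\mathcal B)$ be the set of all terms (parameters and definite descriptions) occurring on $\mathcal B$. Define $\sim$ on $\mathsf{TERM}(\mathcal B)$ by: $t_1\sim t_2$ iff the formula $t_1=t_2$ occurs on $\mathcal B$ or $t_1$ is the same term as $t_2$. Then $\sim$ is an equivalence relation.
   Context: Language. Terms: bound variables $x,y,\dots$, parameters $a,b,\dots$, and definite descriptions (DDs) $\imath x\varphi$; formulas: $P(t_1,\dots,t_n)$, $t_1=t_2$, $\mathtt{E}t$ (existence predicate; absent for $\mathsf{NQFL}^-$), $\neg\varphi$, $\varphi\wedge\psi$, $\forall x\varphi$. $\varphi[x/t]$ is correct substitution; $t_1\neq t_2$ abbreviates $\neg(t_1=t_2)$. Tableau rules (premises $\Rightarrow$ conclusions; "$\mid$" separates branches; $t,t_1,\dots$ terms present on the branch, $b,b_1,b_2$ parameters present on the branch, $a,a_i$ fresh parameters): $(\neg\neg E)$ $\neg\neg\varphi\Rightarrow\varphi$; $(\wedge E)$ $\varphi\wedge\psi\Rightarrow\varphi,\psi$; $(\neg\wedge E)$ $\neg(\varphi\wedge\psi)\Rightarrow\neg\varphi\mid\neg\psi$; $(\bot_1)$ $\varphi,\neg\varphi\Rightarrow\bot$; $(\bot_2)$ $t\neq t\Rightarrow\bot$; $(\bot_3)$ $b\neq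 b\Rightarrow\bot$; $(\forall E_1)$ $\forall x\varphi\Rightarrow\varphi[x/b]$; $(\neg\forall E_1)$ $\neg\forall x\varphi\Rightarrow\neg\varphi[x/a]$; $(\forall E_2)$ $\forall x\varphi,\mathtt{E}b\Rightarrow\varphi[x/b]$; $(\neg\forall E_2)$ $\neg\forall x\varphi\Rightarrow\mathtt{E}a,\neg\varphi[x/a]$; $(=E)$ $t_1\approx t_2,\varphi[x/t_1]\Rightarrow\varphi[x/t_2]$ ($t_1\approx t_2$ is $t_1=t_2$ or $t_2=t_1$); $(=I_1)$ $P(t_1,\dots,t_n)\Rightarrow a_i=t_i$ for $t_i$ a DD; $(=I_2)$ $t_1=t_2\Rightarrow a_i=t_i$ for $t_i$ a DD; $(cut_1)$ $\Rightarrow b=t\mid b\neq t$, $t$ a DD; $(cut_2)$ $\mathtt{E}b\Rightarrow b=t\mid b\neq t$, $t$ a DD; $(\mathtt{E}E_1)$ $\mathtt{E}t\Rightarrow a=t$, $t$ a DD; $(\mathtt{E}E_2)$ $\mathtt{E}t\Rightarrow t=t$; $(\mathtt{E}I_1)$ $P(t_1,\dots,t_n)\Rightarrow\mathtt{E}t_i$ (for $\mathsf{NFL}$ only $t_i$ a DD); $(\mathtt{E}I_2)$ $t_1=t_2\Rightarrow\mathtt{E}t_i$ (for $\mathsf{NFL}$ only $t_i$ a DD); $(\mathtt{E}I_3)$ $\Rightarrow\mathtt{E}b$; $(\mathtt{E}I_4)$ $\Rightarrow\mathtt{E}a$ if no parameters on the branch; $(\imath E_1)$ $b_1=\imath x\varphi\Rightarrow\varphi[x/b_1],\neg\varphi[x/b_2]\mid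 b_1=b_2,\varphi[x/b_1]$; $(\neg\imath E_1)$ $b\neq\imath x\varphi\Rightarrow\neg\varphi[x/b]\mid a\neq b,\varphi[x/a]$; $(\imath E_2)$ $b_1=\imath x\varphi,\mathtt{E}b_1,\mathtt{E}b_2\Rightarrow$ same as $(\imath E_1)$; $(\neg\imath E_2)$ $b\neq\imath x\varphi,\mathtt{E}b\Rightarrow\neg\varphi[x/b]\mid a\neq b,\varphi[x/a],\mathtt{E}a$. Calculi: all contain $(\neg\neg E),(\wedge E),(\neg\wedge E),(\bot_1),(=E)$; additionally $\mathsf{TC}_\mathsf{PFL}$: $(\bot_2),(\forall E_2),(\neg\forall E_2),(cut_2),(\mathtt{E}E_1),(\imath E_2),(\neg\imath E_2)$; $\mathsf{TC}_\mathsf{PQFL}$: $(\bot_2),(\forall E_1),(\neg\forall E_1),(cut_2),(\mathtt{E}E_1),(\mathtt{E}I_3),(\imath E_1),(\neg\imath E_1)$; $\mathsf{TC}_\mathsf{NFL}$: $(\mathtt{E}E_2),(\forall E_2),(\neg\forall E_2),(cut_2),(\mathtt{E}E_1),(\mathtt{E}I_1),(\mathtt{E}I_2),(\imath E_2),(\neg\imath E_2)$; $\mathsf{TC}_\mathsf{NQFL}$: $(\bot_3),(\forall E_1),(\neg\forall E_1),(cut_2),(\mathtt{E}E_1),(\mathtt{E}I_1),(\mathtt{E}I_2),(\mathtt{E}I_3),(\imath E_1),(\neg\imath E_1)$; $\mathsf{TC}_{\mathsf{NQFL}^- }$: $(\bot_3),(\forall E_1),(\neg\forall E_1),(cut_1),(=I_1),(=I_2),(\imath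 E_1),(\neg\imath E_1)$; for $\mathsf{PFL},\mathsf{NFL}$ also $(\mathtt{E}I_4)$ under the non-empty domain assumption. A branch is identified with its set of formulas; it is closed if $\bot$ occurs on it, open otherwise; a rule is applicable to a premise set on a branch if it has not yet been applied to it there; a branch is fully expanded if closed or no rule is applicable (branches may be infinite; rules are applied fairly). -}

module Defs where

open import Data.Nat using (ℕ; _≡ᵇ_)
open import Data.Bool using (Bool; true; false; if_then_else_)
open import Data.List using (List; []; _∷_)
open import Data.List.Membership.Propositional using (_∈_)
open import Data.Product using (Σ; ∃; _×_; _,_; proj₁)
open import Data.Sum using (_⊎_)
open import Data.Empty using (⊥)
open import Data.Unit using (⊤)
open import Relation.Nullary using (¬_)
open import Relation.Binary.PropositionalEquality using (_≡_)

Var : Set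
Var = ℕ

Par : Set
Par = ℕ

PredSym : Set
PredSym = ℕ

mutual
  data Term : Set where
    var  : Var → Term
    par  : Par → Term
    iota : Var → Formula → Term

  data Formula : Set where
    pred : PredSym → List Term → Formula
    _≐_  : Term → Term → Formula
    E    : Term → Formula                  -- existence predicate
    ¬'_  : Formula → Formula
    _∧'_ : Formula → Formula → Formula
    ∀'   : Var → Formula → Formula
    bot  : Formula                         -- the closure marker ⊥ of tableaux

infix 6 _≐_ _≠_

_≠_ : Term → Term → Formula
t₁ ≠ t₂ = ¬' (t₁ ≐ t₂)

-- Substitution φ[x/t] (replacement of the free occurrences of x by t).
-- It is only ever used with closed terms t, so it is capture-free.

mutual
  substT : Var → Term → Term → Term
  substT x t (var y)    = if x ≡ᵇ y then t else var y
  substT x t (par a)    = par a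
  substT x t (iota y φ) = if x ≡ᵇ y then iota y φ else iota y (substF x t φ)

  substL : Var → Term → List Term → List Term
  substL x t []       = []
  substL x t (s ∷ ss) = substT x t s ∷ substL x t ss

  substF : Var → Term → Formula → Formula
  substF x t (pred P ts) = pred P (substL x t ts)
  substF x t (s₁ ≐ s₂)   = substT x t s₁ ≐ substT x t s₂
  substF x t (E s)       = E (substT x t s)
  substF x t (¬' φ)      = ¬' substF x t φ
  substF x t (φ ∧' ψ)    = substF x t φ ∧' substF x t ψ
  substF x t (∀' y φ)    = if x ≡ᵇ y then ∀' y φ else ∀' y (substF x t φ)
  substF x t bot         = bot

_[_/_] : Formula → Var → Term → Formula
φ [ x / t ] = substF x t φ

mutual
  data FreeT (x : Var) : Term → Set where
    fv   : FreeT x (var x)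
    fiota : ∀ {y φ} → ¬ (x ≡ y) → FreeF x φ → FreeT x (iota y φ)

  data FreeL (x : Var) : List Term → Set where
    here  : ∀ {t ts} → FreeT x t → FreeL x (t ∷ ts)
    there : ∀ {t ts} → FreeL x ts → FreeL x (t ∷ ts)

  data FreeF (x : Var) : Formula → Set where
    fpred : ∀ {P ts} → FreeL x ts → FreeF x (pred P ts)
    feq₁  : ∀ {s₁ s₂} → FreeT x s₁ → FreeF x (s₁ ≐ s₂)
    feq₂  : ∀ {s₁ s₂} → FreeT x s₂ → FreeF x (s₁ ≐ s₂)
    fE    : ∀ {s} → FreeT x s → FreeF x (E s)
    fneg  : ∀ {φ} → FreeF x φ → FreeF x (¬' φ)
    fand₁ : ∀ {φ ψ} → FreeF x φ → FreeF x (φ ∧' ψ)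
    fand₂ : ∀ {φ ψ} → FreeF x ψ → FreeF x (φ ∧' ψ)
    fall  : ∀ {y φ} → ¬ (x ≡ y) → FreeF x φ → FreeF x (∀' y φ)

ClosedTerm : Term → Set
ClosedTerm t = ∀ x → ¬ FreeT x t

Sentence : Formula → Set
Sentence φ = ∀ x → ¬ FreeF x φ

mutual
  data HasET : Term → Set where
    hiota : ∀ {y φ} → HasEF φ → HasET (iota y φ)

  data HasEL : List Term → Set where
    here  : ∀ {t ts} → HasET t → HasEL (t ∷ ts)
    there : ∀ {t ts} → HasEL ts → HasEL (t ∷ ts)

  data HasEF : Formula → Set where
    hE    : ∀ {s} → HasEF (E s)
    hpred : ∀ {P ts} → HasEL ts → HasEF (pred P ts)
    heq₁  : ∀ {s₁ s₂} → HasET s₁ → HasEF (s₁ ≐ s₂)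
    heq₂  : ∀ {s₁ s₂} → HasET s₂ → HasEF (s₁ ≐ s₂)
    hneg  : ∀ {φ} → HasEF φ → HasEF (¬' φ)
    hand₁ : ∀ {φ ψ} → HasEF φ → HasEF (φ ∧' ψ)
    hand₂ : ∀ {φ ψ} → HasEF ψ → HasEF (φ ∧' ψ)
    hall  : ∀ {y φ} → HasEF φ → HasEF (∀' y φ)

mutual
  data OccT (t : Term) : Term → Set where
    self  : OccT t t
    oiota : ∀ {y φ} → OccF t φ → OccT t (iota y φ)

  data OccL (t : Term) : List Term → Set where
    here  : ∀ {s ss} → OccT t s → OccL t (s ∷ ss)
    there : ∀ {s ss} → OccL t ss → OccL t (s ∷ ss)

  data OccF (t : Term) : Formula → Set where
    opred : ∀ {P ts} → OccL t ts → OccF t (pred P ts)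
    oeq₁  : ∀ {s₁ s₂} → OccT t s₁ → OccF t (s₁ ≐ s₂)
    oeq₂  : ∀ {s₁ s₂} → OccT t s₂ → OccF t (s₁ ≐ s₂)
    oE    : ∀ {s} → OccT t s → OccF t (E s)
    oneg  : ∀ {φ} → OccF t φ → OccF t (¬' φ)
    oand₁ : ∀ {φ ψ} → OccF t φ → OccF t (φ ∧' ψ)
    oand₂ : ∀ {φ ψ} → OccF t ψ → OccF t (φ ∧' ψ)
    oall  : ∀ {y φ} → OccF t φ → OccF t (∀' y φ)

data IsDD : Term → Set where
  dd : ∀ {x φ} → IsDD (iota x φ)

Branch : Set₁
Branch = Formula → Set

TermOn : Branch → Term → Set
TermOn B t = ClosedTerm t × Σ Formula (λ φ → B φ × OccF t φ)

ParOn : Branch → Par → Set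
ParOn B b = TermOn B (par b)

Open : Branch → Set
Open B = ¬ B bot

data Logic : Set where
  PFL PQFL NFL NQFL NQFL⁻ : Logic

data Rule : Set where
  ¬¬E ∧E ¬∧E ⊥₁ ⊥₂ ⊥₃ ∀E₁ ¬∀E₁ ∀E₂ ¬∀E₂ =E =I₁ =I₂ cut₁ cut₂ : Rule
  EE₁ EE₂ EI₁ EI₁-DD EI₂ EI₂-DD EI₃ EI₄ ιE₁ ¬ιE₁ ιE₂ ¬ιE₂ : Rule

-- The branch is closed under (fully expanded with respect to) a rule:
-- whenever the premises are on the branch (and side conditions hold),
-- the formulas of one of the conclusion alternatives are on the branch
-- (for some choice of the parameters introduced by the rule).
ClosedUnder : Rule → Branch → Set
ClosedUnder ¬¬E B = ∀ φ → B (¬' ¬' φ) → B φ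
ClosedUnder ∧E B = ∀ φ ψ → B (φ ∧' ψ) → B φ × B ψ
ClosedUnder ¬∧E B = ∀ φ ψ → B (¬' (φ ∧' ψ)) → B (¬' φ) ⊎ B (¬' ψ)
ClosedUnder ⊥₁ B = ∀ φ → B φ → B (¬' φ) → B bot
ClosedUnder ⊥₂ B = ∀ t → B (t ≠ t) → B bot
ClosedUnder ⊥₃ B = ∀ b → B (par b ≠ par b) → B bot
ClosedUnder ∀E₁ B = ∀ x φ b → B (∀' x φ) → ParOn B b → B (φ [ x / par b ])
ClosedUnder ¬∀E₁ B = ∀ x φ → B (¬' ∀' x φ) → ∃ λ a → B (¬' (φ [ x / par a ]))
ClosedUnder ∀E₂ B = ∀ x φ b → B (∀' x φ) → B (E (par b)) → B (φ [ x / par b ])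
ClosedUnder ¬∀E₂ B = ∀ x φ → B (¬' ∀' x φ) →
  ∃ λ a → B (E (par a)) × B (¬' (φ [ x / par a ]))
ClosedUnder =E B = ∀ t₁ t₂ x φ → (B (t₁ ≐ t₂) ⊎ B (t₂ ≐ t₁)) →
  B (φ [ x / t₁ ]) → B (φ [ x / t₂ ])
ClosedUnder =I₁ B = ∀ P ts t → B (pred P ts) → t ∈ ts → IsDD t →
  ∃ λ a → B (par a ≐ t)
ClosedUnder =I₂ B = ∀ t₁ t₂ → B (t₁ ≐ t₂) →
  (IsDD t₁ → ∃ λ a → B (par a ≐ t₁)) × (IsDD t₂ → ∃ λ a → B (par a ≐ t₂))
ClosedUnder cut₁ B = ∀ b t → ParOn B b → TermOn B t → IsDD t →
  B (par b ≐ t) ⊎ B (par b ≠ t)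
ClosedUnder cut₂ B = ∀ b t → B (E (par b)) → TermOn B t → IsDD t →
  B (par b ≐ t) ⊎ B (par b ≠ t)
ClosedUnder EE₁ B = ∀ t → B (E t) → IsDD t → ∃ λ a → B (par a ≐ t)
ClosedUnder EE₂ B = ∀ t → B (E t) → B (t ≐ t)
ClosedUnder EI₁ B = ∀ P ts t → B (pred P ts) → t ∈ ts → B (E t)
ClosedUnder EI₁-DD B = ∀ P ts t → B (pred P ts) → t ∈ ts → IsDD t → B (E t)
ClosedUnder EI₂ B = ∀ t₁ t₂ → B (t₁ ≐ t₂) → B (E t₁) × B (E t₂)
ClosedUnder EI₂-DD B = ∀ t₁ t₂ → B (t₁ ≐ t₂) →
  (IsDD t₁ → B (E t₁)) × (IsDD t₂ → B (E t₂))
ClosedUnder EI₃ B = ∀ b → ParOn B b → B (E (par b))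
ClosedUnder EI₄ B = (¬ ∃ λ b → ParOn B b) → ∃ λ a → B (E (par a))
ClosedUnder ιE₁ B = ∀ b₁ b₂ x φ → B (par b₁ ≐ iota x φ) → ParOn B b₂ →
  (B (φ [ x / par b₁ ]) × B (¬' (φ [ x / par b₂ ])))
  ⊎ (B (par b₁ ≐ par b₂) × B (φ [ x / par b₁ ]))
ClosedUnder ¬ιE₁ B = ∀ b x φ → B (par b ≠ iota x φ) →
  B (¬' (φ [ x / par b ]))
  ⊎ (∃ λ a → B (par a ≠ par b) × B (φ [ x / par a ]))
ClosedUnder ιE₂ B = ∀ b₁ b₂ x φ → B (par b₁ ≐ iota x φ) →
  B (E (par b₁)) → B (E (par b₂)) →
  (B (φ [ x / par b₁ ]) × B (¬' (φ [ x / par b₂ ])))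
  ⊎ (B (par b₁ ≐ par b₂) × B (φ [ x / par b₁ ]))
ClosedUnder ¬ιE₂ B = ∀ b x φ → B (par b ≠ iota x φ) → B (E (par b)) →
  B (¬' (φ [ x / par b ]))
  ⊎ (∃ λ a → B (par a ≠ par b) × B (φ [ x / par a ]) × B (E (par a)))

-- Rules of TC_L.  The Bool says whether the non-empty domain assumption
-- is made (it adds (EI₄) for PFL and NFL, and is irrelevant otherwise).
common : List Rule
common = ¬¬E ∷ ∧E ∷ ¬∧E ∷ ⊥₁ ∷ =E ∷ []

infixr 5 _++'_
_++'_ : List Rule → List Rule → List Rule
[] ++' ys = ys
(x ∷ xs) ++' ys = x ∷ (xs ++' ys)

ei4 : Bool → List Rule
ei4 true  = EI₄ ∷ []
ei4 false = []

rules : Logic → Bool → List Rule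
rules PFL   ne = common ++' (⊥₂ ∷ ∀E₂ ∷ ¬∀E₂ ∷ cut₂ ∷ EE₁ ∷ ιE₂ ∷ ¬ιE₂ ∷ []) ++' ei4 ne
rules PQFL  ne = common ++' (⊥₂ ∷ ∀E₁ ∷ ¬∀E₁ ∷ cut₂ ∷ EE₁ ∷ EI₃ ∷ ιE₁ ∷ ¬ιE₁ ∷ [])
rules NFL   ne = common ++' (EE₂ ∷ ∀E₂ ∷ ¬∀E₂ ∷ cut₂ ∷ EE₁ ∷ EI₁-DD ∷ EI₂-DD ∷ ιE₂ ∷ ¬ιE₂ ∷ []) ++' ei4 ne
rules NQFL  ne = common ++' (⊥₃ ∷ ∀E₁ ∷ ¬∀E₁ ∷ cut₂ ∷ EE₁ ∷ EI₁ ∷ EI₂ ∷ EI₃ ∷ ιE₁ ∷ ¬ιE₁ ∷ [])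
rules NQFL⁻ ne = common ++' (⊥₃ ∷ ∀E₁ ∷ ¬∀E₁ ∷ cut₁ ∷ =I₁ ∷ =I₂ ∷ ιE₁ ∷ ¬ιE₁ ∷ [])

FullyExpanded : Logic → Bool → Branch → Set
FullyExpanded L ne B = ∀ r → r ∈ rules L ne → ClosedUnder r B

InLanguage : Logic → Formula → Set
InLanguage NQFL⁻ φ = ¬ HasEF φ
InLanguage _     φ = ⊤

WellFormedBranch : Logic → Branch → Set
WellFormedBranch L B = ∀ φ → B φ → φ ≡ bot ⊎ (Sentence φ × InLanguage L φ)

TERM : Branch → Set
TERM B = Σ Term (TermOn B)

Sim : (B : Branch) → TERM B → TERM B → Set
Sim B (t₁ , _) (t₂ , _) = B (t₁ ≐ t₂) ⊎ t₁ ≡ t₂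

{-# OPTIONS --safe #-}
-- Closure under (=E) alone makes = a partial equivalence on closed terms:
-- from t₁ = t₂, rewriting t₂ to t₁ inside t₁ = t₂ itself gives t₁ = t₁, and
-- rewriting the left t₁ of that to t₂ gives t₂ = t₁; rewriting t₂ to t₃
-- inside t₁ = t₂ gives t₁ = t₃.
module Submission where

open import Defs
open import Data.Bool using (Bool; true; false; T)
open import Data.Nat using (_≡ᵇ_)
open import Data.Nat.Properties using (≡ᵇ⇒≡; ≡⇒≡ᵇ)
open import Data.List using ([]; _∷_)
open import Data.List.Membership.Propositional using (_∈_)
open import Data.List.Relation.Unary.Any using (here; there)
open import Data.Product using (_,_)
open import Data.Sum using (_⊎_; inj₁; inj₂)
open import Function using (_∘_)
open import Relation.Nullary using (¬_; contradiction)
open import Relation.Binary.Structures using (IsEquivalence)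
open import Relation.Binary.PropositionalEquality

≡ᵇ-false⇒≢ : ∀ {x y} → (x ≡ᵇ y) ≡ false → x ≢ y
≡ᵇ-false⇒≢ {x} {y} x≡ᵇy x≡y = subst T x≡ᵇy (≡⇒≡ᵇ x y x≡y)

mutual
  substT-notFree : ∀ x s t → ¬ FreeT x t → substT x s t ≡ t
  substT-notFree x s (var y) x∉ with x ≡ᵇ y in x≡ᵇy
  ... | true  = contradiction (subst (λ z → FreeT x (var z)) (≡ᵇ⇒≡ x y (subst T (sym x≡ᵇy) _)) fv) x∉
  ... | false = refl
  substT-notFree x s (par a) x∉ = refl
  substT-notFree x s (iota y φ) x∉ with x ≡ᵇ y in x≡ᵇy
  ... | true  = refl
  ... | false = cong (iota y) (substF-notFree x s φ (x∉ ∘ fiota (≡ᵇ-false⇒≢ x≡ᵇy)))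

  substL-notFree : ∀ x s ts → ¬ FreeL x ts → substL x s ts ≡ ts
  substL-notFree x s []       x∉ = refl
  substL-notFree x s (t ∷ ts) x∉ =
    cong₂ _∷_ (substT-notFree x s t (x∉ ∘ here)) (substL-notFree x s ts (x∉ ∘ there))

  substF-notFree : ∀ x s φ → ¬ FreeF x φ → substF x s φ ≡ φ
  substF-notFree x s (pred P ts) x∉ = cong (pred P) (substL-notFree x s ts (x∉ ∘ fpred))
  substF-notFree x s (t₁ ≐ t₂)   x∉ =
    cong₂ _≐_ (substT-notFree x s t₁ (x∉ ∘ feq₁)) (substT-notFree x s t₂ (x∉ ∘ feq₂))
  substF-notFree x s (E t)       x∉ = cong E (substT-notFree x s t (x∉ ∘ fE))
  substF-notFree x s (¬' φ)      x∉ = cong ¬'_ (substF-notFree x s φ (x∉ ∘ fneg))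
  substF-notFree x s (φ ∧' ψ)    x∉ =
    cong₂ _∧'_ (substF-notFree x s φ (x∉ ∘ fand₁)) (substF-notFree x s ψ (x∉ ∘ fand₂))
  substF-notFree x s (∀' y φ)    x∉ with x ≡ᵇ y in x≡ᵇy
  ... | true  = refl
  ... | false = cong (∀' y) (substF-notFree x s φ (x∉ ∘ fall (≡ᵇ-false⇒≢ x≡ᵇy)))
  substF-notFree x s bot         x∉ = refl

=E∈rules : ∀ L ne → =E ∈ rules L ne
=E∈rules PFL   ne = there (there (there (there (here refl))))
=E∈rules PQFL  ne = there (there (there (there (here refl))))
=E∈rules NFL   ne = there (there (there (there (here refl))))
=E∈rules NQFL  ne = there (there (there (there (here refl))))
=E∈rules NQFL⁻ ne = there (there (there (there (here refl))))

module _ {B : Branch} (=E-closed : ClosedUnder =E B) where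

  rewriteˡ : ∀ {t₁ t₂ s} → ClosedTerm s →
             B (t₁ ≐ t₂) ⊎ B (t₂ ≐ t₁) → B (t₁ ≐ s) → B (t₂ ≐ s)
  rewriteˡ {t₁} {t₂} {s} s-closed t₁≈t₂ =
    subst B (atVar0 t₂) ∘ =E-closed t₁ t₂ 0 (var 0 ≐ s) t₁≈t₂ ∘ subst B (sym (atVar0 t₁))
    where
    atVar0 : ∀ t → (var 0 ≐ s) [ 0 / t ] ≡ (t ≐ s)
    atVar0 t = cong (t ≐_) (substT-notFree 0 t s (s-closed 0))

  rewriteʳ : ∀ {t₁ t₂ s} → ClosedTerm s →
             B (t₁ ≐ t₂) ⊎ B (t₂ ≐ t₁) → B (s ≐ t₁) → B (s ≐ t₂)
  rewriteʳ {t₁} {t₂} {s} s-closed t₁≈t₂ =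
    subst B (atVar0 t₂) ∘ =E-closed t₁ t₂ 0 (s ≐ var 0) t₁≈t₂ ∘ subst B (sym (atVar0 t₁))
    where
    atVar0 : ∀ t → (s ≐ var 0) [ 0 / t ] ≡ (s ≐ t)
    atVar0 t = cong (_≐ t) (substT-notFree 0 t s (s-closed 0))

  ≐-sym : ∀ {t₁ t₂} → ClosedTerm t₁ → B (t₁ ≐ t₂) → B (t₂ ≐ t₁)
  ≐-sym t₁-closed t₁≐t₂ =
    rewriteˡ t₁-closed (inj₁ t₁≐t₂) (rewriteʳ t₁-closed (inj₂ t₁≐t₂) t₁≐t₂)

  ≐-trans : ∀ {t₁ t₂ t₃} → ClosedTerm t₁ → B (t₁ ≐ t₂) → B (t₂ ≐ t₃) → B (t₁ ≐ t₃)
  ≐-trans t₁-closed t₁≐t₂ t₂≐t₃ = rewriteʳ t₁-closed (inj₁ t₂≐t₃) t₁≐t₂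

  Sim-isEquivalence : IsEquivalence (Sim B)
  Sim-isEquivalence = record
    { refl  = inj₂ refl
    ; sym   = λ { {t₁ , t₁-closed , _} (inj₁ t₁≐t₂) → inj₁ (≐-sym t₁-closed t₁≐t₂)
                ; (inj₂ refl) → inj₂ refl }
    ; trans = λ { {t₁ , t₁-closed , _} (inj₁ t₁≐t₂) (inj₁ t₂≐t₃) → inj₁ (≐-trans t₁-closed t₁≐t₂ t₂≐t₃)
                ; t₁∼t₂ (inj₂ refl) → t₁∼t₂
                ; (inj₂ refl) t₂∼t₃ → t₂∼t₃ }
    }

proposition1 : (L : Logic) (ne : Bool) (B : Branch) →
    WellFormedBranch L B → Open B → FullyExpanded L ne B →
    IsEquivalence (Sim B)
proposition1 L ne B _ _ fullyExpanded = Sim-isEquivalence (fullyExpanded =E (=E∈rules L ne))
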